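{- Let there be a derivation in system $\mathcal{V}$ of $\Gamma\vdash^{(m,e,s)} t:\sigma$ such that $\Gamma$ is tight. Then: (1) if $t\in\mathsf{ne}_v$ or $m=e=0$, then $\sigma$ is a tight type; (2) if $\sigma=[\mathcal{M}\to\tau]$ for some multitype $\mathcal{M}$ and type $\tau$, then $t\notin\mathsf{vr}_v$.
   Context: Terms are $t,u,r ::= x \mid \lambda x.t \mid t\,u \mid t[x\backslash u]$ over a countably infinite set of variables, where $t[x\backslash u]$ (explicit substitution) binds $x$ in $t$; terms are taken modulo $\alpha$-conversion. CBV normal forms: $\mathsf{vr}_v ::= x \mid \mathsf{vr}_v[x\backslash \mathsf{ne}_v]$; $\mathsf{ne}_v ::= \mathsf{vr}_v\,\mathsf{no}_v \mid \mathsf{ne}_v\,\mathsf{no}_v \mid \mathsf{ne}_v[x\backslash\mathsf{ne}_v]$; $\mathsf{no}_v ::= \lambda x.t \mid \mathsf{vr}_v \mid \mathsf{ne}_v \mid \mathsf{no}_v[x\backslash\mathsf{ne}_v]$. Types. Tight types: $\mathtt{tt} ::= \mathtt{n} \mid \mathtt{vl} \mid \mathtt{vr}$. Types $\sigma,\tau ::= \mathtt{tt}\mid\mathcal{M}\mid\mathcal{M}\to\sigma$, with multitypes $\mathcal{M}=[\sigma_i]_{i\in I}$ finite multisets of types ($[\,]$ empty, $\sqcup$ union). Typing contexts $\Gamma$ map variables to multitypes, $[\,]$ for all but finitely many; $(\Gamma+\Delta)(x)=\Gamma(x)\sqcup\Delta(x)$, extended to finite sums; $\Gamma\setminus\!\!\setminus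 x$ maps $x$ to $[\,]$ and agrees with $\Gamma$ elsewhere. Judgements $\Gamma\vdash^{(m,e,s)} t:\sigma$ carry integer counters. System $\mathcal{V}$ has the rules: (var$_p$) $x:[\mathtt{vr}]\vdash^{(0,0,0)} x:\mathtt{vr}$; (val$_p$) $\emptyset\vdash^{(0,0,0)} x:\mathtt{vl}$; (abs$_p$) $\emptyset\vdash^{(0,0,0)}\lambda x.t:\mathtt{vl}$; (app$_p$) from $\Gamma\vdash^{(m,e,s)} t:\mathtt{tt}_1$ with $\mathtt{tt}_1\in\{\mathtt{vr},\mathtt{n}\}$ and $\Delta\vdash^{(m',e',s')} u:\mathtt{tt}_2$ with $\mathtt{tt}_2\in\{\mathtt{vl},\mathtt{n}\}$, infer $\Gamma+\Delta\vdash^{(m+m',e+e',s+s'+1)} t\,u:\mathtt{n}$; (es$_p$) from $\Gamma\vdash^{(m,e,s)} t:\tau$, $\Delta\vdash^{(m',e',s')} u:\mathtt{n}$ and $\Gamma(x)$ tight, infer $(\Gamma\setminus\!\!\setminus x)+\Delta\vdash^{(m+m',e+e',s+s')} t[x\backslash u]:\tau$; (var$_c$) $x:\mathcal{M}\vdash^{(0,1,0)} x:\mathcal{M}$ for any multitype $\mathcal{M}$; (app$_c$) from $\Gamma\vdash^{(m,e,s)} t:[\mathcal{M}\to\tau]$ and $\Delta\vdash^{(m',e',s')} u:\mathcal{M}$, infer $\Gamma+\Delta\vdash^{(m+m'+1,e+e'-1,s+s')} t\,u:\tau$; (appt$_c$) from $\Gamma\vdash^{(m,e,s)} t:[\mathcal{M}\to\tau]$,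 $\Delta\vdash^{(m',e',s')} u:\mathtt{n}$ and $\mathcal{M}$ tight, infer $\Gamma+\Delta\vdash^{(m+m'+1,e+e'-1,s+s')} t\,u:\tau$; (abs$_c$) from $\Gamma_i\vdash^{(m_i,e_i,s_i)} t:\tau_i$ for each $i\in I$ ($I$ finite, possibly empty), infer $+_{i\in I}(\Gamma_i\setminus\!\!\setminus x)\vdash^{(\sum_i m_i,\,1+\sum_i e_i,\,\sum_i s_i)}\lambda x.t:[\Gamma_i(x)\to\tau_i]_{i\in I}$; (es$_c$) from $\Gamma\vdash^{(m,e,s)} t:\sigma$ and $\Delta\vdash^{(m',e',s')} u:\Gamma(x)$, infer $(\Gamma\setminus\!\!\setminus x)+\Delta\vdash^{(m+m',e+e',s+s')} t[x\backslash u]:\sigma$. A multitype is tight if all its elements are tight types; a context is tight if all its multitypes are tight. -}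

module Defs where

open import Data.Nat using (ℕ; _≟_)
open import Data.Integer using (ℤ; _+_; _-_; 0ℤ; 1ℤ)
open import Data.List using (List; []; _∷_; _++_)
open import Data.List.Relation.Unary.All using (All)
open import Relation.Nullary using (yes; no)
open import Relation.Binary.PropositionalEquality using (_≡_)
open import Data.Sum using (_⊎_)

-- Terms (named variables ranging over ℕ; raw syntax)

data Term : Set where
  var  : ℕ → Term
  lam  : ℕ → Term → Term
  app  : Term → Term → Term
  _[_∖_] : Term → ℕ → Term → Term     -- t [ x \ u ]  (binds x in t)

data Vr : Term → Set
data Ne : Term → Set
data No : Term → Set

data Vr where
  vr-var : ∀ {x} → Vr (var x)
  vr-es  : ∀ {t x u} → Vr t → Ne u → Vr (t [ x ∖ u ])

data Ne where
  ne-vr  : ∀ {t u} → Vr t → No u → Ne (app t u)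
  ne-app : ∀ {t u} → Ne t → No u → Ne (app t u)
  ne-es  : ∀ {t x u} → Ne t → Ne u → Ne (t [ x ∖ u ])

data No where
  no-lam : ∀ {x t} → No (lam x t)
  no-vr  : ∀ {t} → Vr t → No t
  no-ne  : ∀ {t} → Ne t → No t
  no-es  : ∀ {t x u} → No t → Ne u → No (t [ x ∖ u ])

-- Types.  Multitypes are finite multisets, represented as lists taken
-- up to (deep) permutation, see _≈T_ / _≈M_ and the conversion rule.

data Ty : Set where
  n vl vr : Ty
  mty : List Ty → Ty
  _⇒_ : List Ty → Ty → Ty

MTy : Set
MTy = List Ty

data IsTightTy : Ty → Set where
  tight-n  : IsTightTy n
  tight-vl : IsTightTy vl
  tight-vr : IsTightTy vr

TightM : MTy → Set
TightM M = All IsTightTy M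

data _≈T_ : Ty → Ty → Set
data _≈M_ : MTy → MTy → Set

data _≈T_ where
  ≈n   : n ≈T n
  ≈vl  : vl ≈T vl
  ≈vr  : vr ≈T vr
  ≈mty : ∀ {M N} → M ≈M N → mty M ≈T mty N
  ≈⇒   : ∀ {M N σ τ} → M ≈M N → σ ≈T τ → (M ⇒ σ) ≈T (N ⇒ τ)

data _≈M_ where
  ≈[]    : [] ≈M []
  ≈∷     : ∀ {σ τ M N} → σ ≈T τ → M ≈M N → (σ ∷ M) ≈M (τ ∷ N)
  ≈swap  : ∀ σ τ M → (σ ∷ τ ∷ M) ≈M (τ ∷ σ ∷ M)
  ≈trans : ∀ {M N P} → M ≈M N → N ≈M P → M ≈M P

Ctx : Set
Ctx = ℕ → MTy

∅ : Ctx
∅ _ = []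

_∶∶_ : ℕ → MTy → Ctx
(x ∶∶ M) y with y ≟ x
... | yes _ = M
... | no  _ = []

_⊕_ : Ctx → Ctx → Ctx
(Γ ⊕ Δ) y = Γ y ++ Δ y

_∖∖_ : Ctx → ℕ → Ctx
(Γ ∖∖ x) y with y ≟ x
... | yes _ = []
... | no  _ = Γ y

_≈C_ : Ctx → Ctx → Set
Γ ≈C Δ = ∀ y → Γ y ≈M Δ y

TightCtx : Ctx → Set
TightCtx Γ = ∀ y → TightM (Γ y)

infix 4 _⊢_∶_▸_,_,_
data _⊢_∶_▸_,_,_ : Ctx → Term → Ty → ℤ → ℤ → ℤ → Set

-- premises of abs_c, indexed by a finite family I (a list)
data AbsPrems (x : ℕ) (t : Term) : Ctx → MTy → ℤ → ℤ → ℤ → Set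

data _⊢_∶_▸_,_,_ where
  var-p : ∀ {x} → (x ∶∶ (vr ∷ [])) ⊢ var x ∶ vr ▸ 0ℤ , 0ℤ , 0ℤ
  val-p : ∀ {x} → ∅ ⊢ var x ∶ vl ▸ 0ℤ , 0ℤ , 0ℤ
  abs-p : ∀ {x t} → ∅ ⊢ lam x t ∶ vl ▸ 0ℤ , 0ℤ , 0ℤ
  app-p : ∀ {Γ Δ t u tt₁ tt₂ m e s m' e' s'}
        → Γ ⊢ t ∶ tt₁ ▸ m , e , s → (tt₁ ≡ vr ⊎ tt₁ ≡ n)
        → Δ ⊢ u ∶ tt₂ ▸ m' , e' , s' → (tt₂ ≡ vl ⊎ tt₂ ≡ n)
        → (Γ ⊕ Δ) ⊢ app t u ∶ n ▸ m + m' , e + e' , s + s' + 1ℤ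
  es-p  : ∀ {Γ Δ t u x τ m e s m' e' s'}
        → Γ ⊢ t ∶ τ ▸ m , e , s → Δ ⊢ u ∶ n ▸ m' , e' , s'
        → TightM (Γ x)
        → ((Γ ∖∖ x) ⊕ Δ) ⊢ t [ x ∖ u ] ∶ τ ▸ m + m' , e + e' , s + s'
  var-c : ∀ {x M} → (x ∶∶ M) ⊢ var x ∶ mty M ▸ 0ℤ , 1ℤ , 0ℤ
  app-c : ∀ {Γ Δ t u M τ m e s m' e' s'}
        → Γ ⊢ t ∶ mty ((M ⇒ τ) ∷ []) ▸ m , e , s → Δ ⊢ u ∶ mty M ▸ m' , e' , s'
        → (Γ ⊕ Δ) ⊢ app t u ∶ τ ▸ m + m' + 1ℤ , e + e' - 1ℤ , s + s'
  appt-c : ∀ {Γ Δ t u M τ m e s m' e' s'}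
        → Γ ⊢ t ∶ mty ((M ⇒ τ) ∷ []) ▸ m , e , s → Δ ⊢ u ∶ n ▸ m' , e' , s'
        → TightM M
        → (Γ ⊕ Δ) ⊢ app t u ∶ τ ▸ m + m' + 1ℤ , e + e' - 1ℤ , s + s'
  abs-c : ∀ {Γ x t M m e s}
        → AbsPrems x t Γ M m e s
        → Γ ⊢ lam x t ∶ mty M ▸ m , 1ℤ + e , s
  es-c  : ∀ {Γ Δ t u x σ m e s m' e' s'}
        → Γ ⊢ t ∶ σ ▸ m , e , s → Δ ⊢ u ∶ mty (Γ x) ▸ m' , e' , s'
        → ((Γ ∖∖ x) ⊕ Δ) ⊢ t [ x ∖ u ] ∶ σ ▸ m + m' , e + e' , s + s'
  -- multitypes are multisets: derivations are closed under multiset equality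
  conv  : ∀ {Γ Γ' t σ σ' m e s}
        → Γ ⊢ t ∶ σ ▸ m , e , s → Γ ≈C Γ' → σ ≈T σ'
        → Γ' ⊢ t ∶ σ' ▸ m , e , s

data AbsPrems x t where
  prems[] : AbsPrems x t ∅ [] 0ℤ 0ℤ 0ℤ
  prems∷  : ∀ {Γ Δ τ M m e s m' e' s'}
          → Γ ⊢ t ∶ τ ▸ m , e , s
          → AbsPrems x t Δ M m' e' s'
          → AbsPrems x t ((Γ ∖∖ x) ⊕ Δ) ((Γ x ⇒ τ) ∷ M) (m + m') (e + e') (s + s')

-- Each var-c or abs-c rule adds 1 to e and each app-c or appt-c rule moves
-- 1 from e to m, so m + e is the number of var-c and abs-c rules of the
-- derivation. When it is 0, an app-c or appt-c rule is impossible: its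
-- function premise would also have weight 0 and yet the non-tight type
-- [M → τ]; every other rule then yields a tight type.
-- The claims about ne_v and vr_v are proved together by induction: in a
-- tight context a neutral term gets a tight type and a variable-like term
-- only a tight multitype, which rules out both the type [M → τ] for the
-- head of an application and a multitype for the argument of an es-c.
module Submission where

open import Defs
open import Data.Integer using (ℤ; 0ℤ; 1ℤ; +_; _-_) renaming (_+_ to _+ℤ_)
open import Data.Integer.Properties using (pos-+; +-injective)
open import Data.Integer.Tactic.RingSolver using (solve-∀)
open import Data.Nat using (ℕ; suc; _+_; _≟_)
open import Data.Nat.Properties using (m+n≡0⇒m≡0)
open import Data.List using ([]; _∷_)
open import Data.List.Relation.Unary.All using (_∷_)
open import Data.List.Relation.Unary.All.Properties using (++⁻ˡ; ++⁻ʳ)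
open import Data.Product using (_×_; _,_)
open import Data.Sum using (_⊎_; inj₁; inj₂)
open import Relation.Nullary using (¬_; yes; no; contradiction)
open import Relation.Binary.PropositionalEquality
  using (_≡_; refl; sym; trans)

≈T-sym : ∀ {σ τ} → σ ≈T τ → τ ≈T σ
≈M-sym : ∀ {M N} → M ≈M N → N ≈M M
≈T-sym ≈n           = ≈n
≈T-sym ≈vl          = ≈vl
≈T-sym ≈vr          = ≈vr
≈T-sym (≈mty M≈N)   = ≈mty (≈M-sym M≈N)
≈T-sym (≈⇒ M≈N σ≈τ) = ≈⇒ (≈M-sym M≈N) (≈T-sym σ≈τ)
≈M-sym ≈[]              = ≈[]
≈M-sym (≈∷ σ≈τ M≈N)     = ≈∷ (≈T-sym σ≈τ) (≈M-sym M≈N)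
≈M-sym (≈swap σ τ M)    = ≈swap τ σ M
≈M-sym (≈trans M≈N N≈P) = ≈trans (≈M-sym N≈P) (≈M-sym M≈N)

IsTightTy-resp-≈ : ∀ {σ τ} → σ ≈T τ → IsTightTy σ → IsTightTy τ
IsTightTy-resp-≈ ≈n       tight = tight
IsTightTy-resp-≈ ≈vl      tight = tight
IsTightTy-resp-≈ ≈vr      tight = tight
IsTightTy-resp-≈ (≈mty _) ()
IsTightTy-resp-≈ (≈⇒ _ _) ()

TightM-resp-≈ : ∀ {M N} → M ≈M N → TightM M → TightM N
TightM-resp-≈ ≈[]              tight             = tight
TightM-resp-≈ (≈∷ σ≈τ M≈N)     (σ-tight ∷ tight) =
  IsTightTy-resp-≈ σ≈τ σ-tight ∷ TightM-resp-≈ M≈N tight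
TightM-resp-≈ (≈swap _ _ _)    (σ-tight ∷ τ-tight ∷ tight) = τ-tight ∷ σ-tight ∷ tight
TightM-resp-≈ (≈trans M≈N N≈P) tight = TightM-resp-≈ N≈P (TightM-resp-≈ M≈N tight)

≈C-sym : ∀ {Γ Δ} → Γ ≈C Δ → Δ ≈C Γ
≈C-sym Γ≈Δ y = ≈M-sym (Γ≈Δ y)

TightCtx-resp-≈ : ∀ {Γ Δ} → Γ ≈C Δ → TightCtx Γ → TightCtx Δ
TightCtx-resp-≈ Γ≈Δ tight y = TightM-resp-≈ (Γ≈Δ y) (tight y)

TightCtx-⊕⁻ˡ : ∀ {Γ Δ} → TightCtx (Γ ⊕ Δ) → TightCtx Γ
TightCtx-⊕⁻ˡ {Γ} tight y = ++⁻ˡ (Γ y) (tight y)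

TightCtx-⊕⁻ʳ : ∀ {Γ Δ} → TightCtx (Γ ⊕ Δ) → TightCtx Δ
TightCtx-⊕⁻ʳ {Γ} tight y = ++⁻ʳ (Γ y) (tight y)

TightCtx-∖∖⁻ : ∀ {Γ x} → TightM (Γ x) → TightCtx (Γ ∖∖ x) → TightCtx Γ
TightCtx-∖∖⁻ {x = x} x-tight tight y with y ≟ x | tight y
... | yes refl | _       = x-tight
... | no _     | y-tight = y-tight

TightCtx-∶∶⁻ : ∀ {x M} → TightCtx (x ∶∶ M) → TightM M
TightCtx-∶∶⁻ {x} tight with x ≟ x | tight x
... | yes _ | M-tight = M-tight
... | no x≢x | _      = contradiction refl x≢x

weight  : ∀ {Γ t σ m e s} → Γ ⊢ t ∶ σ ▸ m , e , s → ℕ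
weightᴾ : ∀ {x t Γ M m e s} → AbsPrems x t Γ M m e s → ℕ
weight var-p            = 0
weight val-p            = 0
weight abs-p            = 0
weight (app-p d _ d' _) = weight d + weight d'
weight (es-p d d' _)    = weight d + weight d'
weight var-c            = 1
weight (app-c d d')     = weight d + weight d'
weight (appt-c d d' _)  = weight d + weight d'
weight (abs-c ds)       = suc (weightᴾ ds)
weight (es-c d d')      = weight d + weight d'
weight (conv d _ _)     = weight d
weightᴾ prems[]         = 0
weightᴾ (prems∷ d ds)   = weight d + weightᴾ ds

private
  +-interchange : ∀ m e m' e' → (m +ℤ m') +ℤ (e +ℤ e') ≡ (m +ℤ e) +ℤ (m' +ℤ e')
  +-interchange = solve-∀

  app-c-counters : ∀ m e m' e' →
    (m +ℤ m' +ℤ 1ℤ) +ℤ (e +ℤ e' - 1ℤ) ≡ (m +ℤ e) +ℤ (m' +ℤ e')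
  app-c-counters = solve-∀

  abs-c-counters : ∀ m e → m +ℤ (1ℤ +ℤ e) ≡ 1ℤ +ℤ (m +ℤ e)
  abs-c-counters = solve-∀

  pos-+-resp : ∀ {a b} {i j : ℤ} → + a ≡ i → + b ≡ j → + (a + b) ≡ i +ℤ j
  pos-+-resp {a} {b} refl refl = pos-+ a b

+weight≡m+e  : ∀ {Γ t σ m e s} (d : Γ ⊢ t ∶ σ ▸ m , e , s) → + weight d ≡ m +ℤ e
+weightᴾ≡m+e : ∀ {x t Γ M m e s} (ds : AbsPrems x t Γ M m e s) → + weightᴾ ds ≡ m +ℤ e
+weight≡m+e var-p = refl
+weight≡m+e val-p = refl
+weight≡m+e abs-p = refl
+weight≡m+e (app-p {m = m} {e} {m' = m'} {e'} d _ d' _) =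
  trans (pos-+-resp (+weight≡m+e d) (+weight≡m+e d')) (sym (+-interchange m e m' e'))
+weight≡m+e (es-p {m = m} {e} {m' = m'} {e'} d d' _) =
  trans (pos-+-resp (+weight≡m+e d) (+weight≡m+e d')) (sym (+-interchange m e m' e'))
+weight≡m+e var-c = refl
+weight≡m+e (app-c {m = m} {e} {m' = m'} {e'} d d') =
  trans (pos-+-resp (+weight≡m+e d) (+weight≡m+e d')) (sym (app-c-counters m e m' e'))
+weight≡m+e (appt-c {m = m} {e} {m' = m'} {e'} d d' _) =
  trans (pos-+-resp (+weight≡m+e d) (+weight≡m+e d')) (sym (app-c-counters m e m' e'))
+weight≡m+e (abs-c {m = m} {e} ds) =
  trans (pos-+-resp {1} refl (+weightᴾ≡m+e ds)) (sym (abs-c-counters m e))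
+weight≡m+e (es-c {m = m} {e} {m' = m'} {e'} d d') =
  trans (pos-+-resp (+weight≡m+e d) (+weight≡m+e d')) (sym (+-interchange m e m' e'))
+weight≡m+e (conv d _ _) = +weight≡m+e d
+weightᴾ≡m+e prems[] = refl
+weightᴾ≡m+e (prems∷ {m = m} {e} {m' = m'} {e'} d ds) =
  trans (pos-+-resp (+weight≡m+e d) (+weightᴾ≡m+e ds)) (sym (+-interchange m e m' e'))

weight≡0⇒IsTightTy : ∀ {Γ t σ m e s} (d : Γ ⊢ t ∶ σ ▸ m , e , s) → weight d ≡ 0 → IsTightTy σ
weight≡0⇒IsTightTy var-p            _   = tight-vr
weight≡0⇒IsTightTy val-p            _   = tight-vl
weight≡0⇒IsTightTy abs-p            _   = tight-vl
weight≡0⇒IsTightTy (app-p _ _ _ _)  _   = tight-n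
weight≡0⇒IsTightTy (es-p d _ _)     w≡0 = weight≡0⇒IsTightTy d (m+n≡0⇒m≡0 _ w≡0)
weight≡0⇒IsTightTy (app-c d _)      w≡0 with weight≡0⇒IsTightTy d (m+n≡0⇒m≡0 _ w≡0)
... | ()
weight≡0⇒IsTightTy (appt-c d _ _)   w≡0 with weight≡0⇒IsTightTy d (m+n≡0⇒m≡0 _ w≡0)
... | ()
weight≡0⇒IsTightTy (es-c d _)       w≡0 = weight≡0⇒IsTightTy d (m+n≡0⇒m≡0 _ w≡0)
weight≡0⇒IsTightTy (conv d _ σ≈σ')  w≡0 = IsTightTy-resp-≈ σ≈σ' (weight≡0⇒IsTightTy d w≡0)

m≡0∧e≡0⇒IsTightTy : ∀ {Γ t σ m e s} → Γ ⊢ t ∶ σ ▸ m , e , s → m ≡ 0ℤ → e ≡ 0ℤ → IsTightTy σ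
m≡0∧e≡0⇒IsTightTy d refl refl = weight≡0⇒IsTightTy d (+-injective (+weight≡m+e d))

Ne⇒IsTightTy : ∀ {Γ t σ m e s} → Γ ⊢ t ∶ σ ▸ m , e , s → TightCtx Γ → Ne t → IsTightTy σ
Vr⇒TightM    : ∀ {Γ t M m e s} → Γ ⊢ t ∶ mty M ▸ m , e , s → TightCtx Γ → Vr t → TightM M
Ne⇒IsTightTy (app-p _ _ _ _) _ _ = tight-n
Ne⇒IsTightTy (app-c d _) Γ-tight (ne-vr t-vr _)
  with Vr⇒TightM d (TightCtx-⊕⁻ˡ Γ-tight) t-vr
... | () ∷ _
Ne⇒IsTightTy (app-c d _) Γ-tight (ne-app t-ne _)
  with Ne⇒IsTightTy d (TightCtx-⊕⁻ˡ Γ-tight) t-ne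
... | ()
Ne⇒IsTightTy (appt-c d _ _) Γ-tight (ne-vr t-vr _)
  with Vr⇒TightM d (TightCtx-⊕⁻ˡ Γ-tight) t-vr
... | () ∷ _
Ne⇒IsTightTy (appt-c d _ _) Γ-tight (ne-app t-ne _)
  with Ne⇒IsTightTy d (TightCtx-⊕⁻ˡ Γ-tight) t-ne
... | ()
Ne⇒IsTightTy (es-p d _ x-tight) Γ-tight (ne-es t-ne _) =
  Ne⇒IsTightTy d (TightCtx-∖∖⁻ x-tight (TightCtx-⊕⁻ˡ Γ-tight)) t-ne
Ne⇒IsTightTy (es-c _ d') Γ-tight (ne-es _ u-ne) with Ne⇒IsTightTy d' (TightCtx-⊕⁻ʳ Γ-tight) u-ne
... | ()
Ne⇒IsTightTy (conv d Γ≈Γ' σ≈σ') Γ'-tight t-ne =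
  IsTightTy-resp-≈ σ≈σ' (Ne⇒IsTightTy d (TightCtx-resp-≈ (≈C-sym Γ≈Γ') Γ'-tight) t-ne)
Vr⇒TightM var-c Γ-tight vr-var = TightCtx-∶∶⁻ Γ-tight
Vr⇒TightM (es-p d _ x-tight) Γ-tight (vr-es t-vr _) =
  Vr⇒TightM d (TightCtx-∖∖⁻ x-tight (TightCtx-⊕⁻ˡ Γ-tight)) t-vr
Vr⇒TightM (es-c _ d') Γ-tight (vr-es _ u-ne) with Ne⇒IsTightTy d' (TightCtx-⊕⁻ʳ Γ-tight) u-ne
... | ()
Vr⇒TightM (conv d Γ≈Γ' (≈mty M≈M')) Γ'-tight t-vr =
  TightM-resp-≈ M≈M' (Vr⇒TightM d (TightCtx-resp-≈ (≈C-sym Γ≈Γ') Γ'-tight) t-vr)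

lemma4p2 : ∀ {Γ t σ m e s}
    → Γ ⊢ t ∶ σ ▸ m , e , s
    → TightCtx Γ
    → ((Ne t ⊎ (m ≡ 0ℤ × e ≡ 0ℤ)) → IsTightTy σ)
      × (∀ M τ → σ ≡ mty ((M ⇒ τ) ∷ []) → ¬ Vr t)
lemma4p2 {t = t} {σ} {m} {e} d Γ-tight = tight-type , not-variable
  where
  tight-type : Ne t ⊎ (m ≡ 0ℤ × e ≡ 0ℤ) → IsTightTy σ
  tight-type (inj₁ t-ne)         = Ne⇒IsTightTy d Γ-tight t-ne
  tight-type (inj₂ (m≡0 , e≡0)) = m≡0∧e≡0⇒IsTightTy d m≡0 e≡0
  not-variable : ∀ M τ → σ ≡ mty ((M ⇒ τ) ∷ []) → ¬ Vr t
  not-variable M τ refl t-vr with Vr⇒TightM d Γ-tight t-vr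
  ... | () ∷ _
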